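{- Let $b\ge 2$ and $n\ge 0$ be integers, and let the sets $S_i,I_i,C_i$ ($i\ge 0$) be defined as in the context. Then for every $i\ge 0$, $$I_i=\{\mathrm{inc}_i(p): p\in P_{i+1}(b,n)\}\quad\text{and}\quad C_i=\{\mathrm{inc}_{i+1}(p): p\in P_{i+1}(b,n)\}.$$
   Context: For an integer $m\ge 0$, a $b$-ary partition of $m$ is a sequence $p=(p_0,p_1,\dots)$ of non-negative integers, only finitely many nonzero, with $\sum_{j\ge0}p_jb^j=m$ (written as finite tuples, later components being $0$). Firing $j$ (allowed when $p_j\ge b$) transforms $p$ into $q$ with $q_j=p_j-b$, $q_{j+1}=p_{j+1}+1$, other components unchanged; $q$ is a successor of $p$ and $\mathrm{Succ}_b(p)$ is the set of successors of $p$. $R_b(m)$ is the set of $b$-ary partitions of $m$ obtainable from $(m,0,0,\dots)$ by finitely many firings. For $i\ge0$, $P_i(b,n)$ is the set of $p\in R_b(n)$ with $p_0=\dots=p_{i-1}=b-1$. For $p\in P_i(b,n)$, $\mathrm{inc}_i(p)=(0,\dots,0,p_i+1,p_{i+1},\dots)$ ($i$ leading zeros), a $b$-ary partition of $n+1$. Construction of $R_b(n+1)$ from $R_b(n)$: let $S_0=\{\mathrm{inc}_0(p):p\in R_b(n)\}$; let $I_0=\{x\in S_0:\mathrm{Succ}_b(x)\not\subseteq S_0\}$, $C_0=\bigl(\bigcup_{x\in I_0}\mathrm{Succ}_b(x)\bigr)\setminus S_0$, $S_1=S_0\cup C_0$; and for $i\ge1$, $I_i=\{x\in C_{i-1}:\mathrm{Succ}_b(x)\not\subseteq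 S_i\}$, $C_i=\bigl(\bigcup_{x\in I_i}\mathrm{Succ}_b(x)\bigr)\setminus S_i$, $S_{i+1}=S_i\cup C_i$. (Thus $I_i$ is the set of newly added elements having a successor not yet constructed, and $C_i$ the set of these missing successors.) -}

module Defs where

open import Data.Nat using (ℕ; zero; suc; _∸_; _≤_; _<_)
open import Data.Product using (Σ; ∃; _×_)
open import Data.Sum using (_⊎_)
open import Relation.Nullary using (¬_)
open import Relation.Binary.PropositionalEquality using (_≡_; _≢_)

-- A (b-ary) partition is represented by its sequence of parts p : ℕ → ℕ,
-- p j being the multiplicity of b^j.  Partitions are compared pointwise.
Part : Set
Part = ℕ → ℕ

_≈_ : Part → Part → Set
p ≈ q = ∀ k → p k ≡ q k

initial : ℕ → Part
initial m zero    = m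
initial m (suc k) = 0

Fire : ℕ → ℕ → Part → Part → Set
Fire b j p q =
  (b ≤ p j) × (q j ≡ p j ∸ b) × (q (suc j) ≡ suc (p (suc j)))
  × (∀ k → k ≢ j → k ≢ suc j → q k ≡ p k)

Succ : ℕ → Part → Part → Set
Succ b p q = Σ ℕ λ j → Fire b j p q

data R (b m : ℕ) : Part → Set where
  start : ∀ {p} → p ≈ initial m → R b m p
  step  : ∀ {p q} j → R b m p → Fire b j p q → R b m q

P : ℕ → ℕ → ℕ → Part → Set
P i b n p = R b n p × (∀ k → k < i → p k ≡ b ∸ 1)

-- inc_i(p) = (0,...,0, p_i + 1, p_{i+1}, ...)  with i leading zeros
inc : ℕ → Part → Part
inc zero    p zero    = suc (p zero)
inc zero    p (suc k) = p (suc k)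
inc (suc i) p zero    = 0
inc (suc i) p (suc k) = inc i (λ j → p (suc j)) k

-- The construction of R_b(n+1) from R_b(n): sets as predicates on Part.
S₀ : ℕ → ℕ → Part → Set
S₀ b n x = Σ Part λ p → R b n p × (x ≈ inc 0 p)

SuccNotIn : ℕ → (Part → Set) → Part → Set
SuccNotIn b T x = Σ Part λ y → Succ b x y × ¬ T y

mutual
  S : ℕ → ℕ → ℕ → Part → Set
  S b n zero    x = S₀ b n x
  S b n (suc i) x = S b n i x ⊎ C b n i x

  I : ℕ → ℕ → ℕ → Part → Set
  I b n zero    x = S₀ b n x × SuccNotIn b (S b n zero) x
  I b n (suc i) x = C b n i x × SuccNotIn b (S b n (suc i)) x

  C : ℕ → ℕ → ℕ → Part → Set
  C b n i y = (Σ Part λ x → I b n i x × Succ b x y) × ¬ S b n i y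

-- An element inc_i p with p ∈ P_i can only leave S_i by firing position i, and
-- only when p_i = b - 1: firing any other admissible position j ≥ i of inc_i p
-- is the same as firing j in p, which keeps us inside inc_i[P_i] ⊆ S_i.  Hence
-- I_i = inc_i[P_{i+1}] and its missing successors are C_i = inc_{i+1}[P_{i+1}];
-- these really are missing because they vanish at positions 0..i, whereas every
-- element of S_i has a nonzero part at some position ≤ i.  Induction on i
-- carries both facts along, starting from S_0 = inc_0[P_0].

module Submission where

open import Defs
open import Data.Nat using (ℕ; zero; suc; _≤_; _<_; _∸_; s≤s; _≤?_)
open import Data.Nat.Properties
open import Data.Product using (Σ; _×_; _,_; proj₁; proj₂)
open import Data.Sum using (inj₁; inj₂)
open import Function.Base using (id; _∘_)
open import Function.Bundles using (_⇔_; mk⇔; Equivalence)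
open import Relation.Nullary using (¬_; yes; no; contradiction)
open import Relation.Binary.PropositionalEquality

open Equivalence

≈-refl : ∀ {p} → p ≈ p
≈-refl k = refl

≈-sym : ∀ {p q} → p ≈ q → q ≈ p
≈-sym e k = sym (e k)

tail : Part → Part
tail p k = p (suc k)

Fire-resp-≈ : ∀ {b j p p′ q q′} → p ≈ p′ → q ≈ q′ → Fire b j p q → Fire b j p′ q′
Fire-resp-≈ {b} {j} p≈ q≈ (b≤ , at , next , rest) =
  subst (b ≤_) (p≈ j) b≤ ,
  trans (sym (q≈ j)) (trans at (cong (_∸ b) (p≈ j))) ,
  trans (sym (q≈ (suc j))) (trans next (cong suc (p≈ (suc j)))) ,
  λ k k≢j k≢sj → trans (sym (q≈ k)) (trans (rest k k≢j k≢sj) (p≈ k))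

Fire-suc : ∀ {b j p q} → Fire b j (tail p) (tail q) → p 0 ≡ q 0 → Fire b (suc j) p q
Fire-suc {j = j} {p} {q} (b≤ , at , next , rest) p₀≡q₀ = b≤ , at , next , others
  where
  others : ∀ k → k ≢ suc j → k ≢ suc (suc j) → q k ≡ p k
  others zero    _    _     = sym p₀≡q₀
  others (suc k) k≢sj k≢ssj = rest k (k≢sj ∘ cong suc) (k≢ssj ∘ cong suc)

Fire-tail : ∀ {b j p q} → Fire b (suc j) p q → Fire b j (tail p) (tail q) × p 0 ≡ q 0
Fire-tail (b≤ , at , next , rest) =
  (b≤ , at , next , λ k k≢j k≢sj → rest (suc k) (k≢j ∘ suc-injective) (k≢sj ∘ suc-injective)) ,
  sym (rest 0 (λ ()) (λ ()))

fire : ℕ → ℕ → Part → Part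
fire b zero    p zero          = p 0 ∸ b
fire b zero    p (suc zero)    = suc (p 1)
fire b zero    p (suc (suc k)) = p (suc (suc k))
fire b (suc j) p zero          = p 0
fire b (suc j) p (suc k)       = fire b j (tail p) k

Fire-fire : ∀ {b} j p → b ≤ p j → Fire b j p (fire b j p)
Fire-fire {b} zero p b≤ = b≤ , refl , refl , others
  where
  others : ∀ k → k ≢ 0 → k ≢ 1 → fire b 0 p k ≡ p k
  others zero          k≢0 _   = contradiction refl k≢0
  others (suc zero)    _   k≢1 = contradiction refl k≢1
  others (suc (suc k)) _   _   = refl
Fire-fire (suc j) p b≤ = Fire-suc (Fire-fire j (tail p) b≤) refl

Fire⇒≈fire : ∀ {b} j {p q} → Fire b j p q → q ≈ fire b j p
Fire⇒≈fire zero    (_ , at , _ , _)    zero          = at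
Fire⇒≈fire zero    (_ , _ , next , _)  (suc zero)    = next
Fire⇒≈fire zero    (_ , _ , _ , rest)  (suc (suc k)) = rest (suc (suc k)) (λ ()) (λ ())
Fire⇒≈fire (suc j) f                   zero          = sym (proj₂ (Fire-tail f))
Fire⇒≈fire (suc j) f                   (suc k)       = Fire⇒≈fire j (proj₁ (Fire-tail f)) k

Fire-functional : ∀ {b j p q q′} → Fire b j p q → Fire b j p q′ → q ≈ q′
Fire-functional {j = j} f f′ k = trans (Fire⇒≈fire j f k) (sym (Fire⇒≈fire j f′ k))

inc-below : ∀ i p k → k < i → inc i p k ≡ 0
inc-below (suc i) p zero    _         = refl
inc-below (suc i) p (suc k) (s≤s k<i) = inc-below i (tail p) k k<i

inc-at : ∀ i p → inc i p i ≡ suc (p i)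
inc-at zero    p = refl
inc-at (suc i) p = inc-at i (tail p)

inc-above : ∀ i p k → i < k → inc i p k ≡ p k
inc-above zero    p (suc k) _         = refl
inc-above (suc i) p (suc k) (s≤s i<k) = inc-above i (tail p) k i<k

Fire-inc : ∀ {b} i j {p q} → i ≤ j → Fire b j p q → Fire b j (inc i p) (inc i q)
Fire-inc {b} zero zero {p} {q} _ (b≤ , at , next , rest) =
  m≤n⇒m≤1+n b≤ , trans (cong suc at) (sym (+-∸-assoc 1 b≤)) , next , others
  where
  others : ∀ k → k ≢ 0 → k ≢ 1 → inc 0 q k ≡ inc 0 p k
  others zero          k≢0 _   = contradiction refl k≢0
  others (suc zero)    _   k≢1 = contradiction refl k≢1
  others (suc (suc k)) k≢0 k≢1 = rest (suc (suc k)) k≢0 k≢1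
Fire-inc zero    (suc j) _         f = Fire-suc (proj₁ (Fire-tail f)) (cong suc (proj₂ (Fire-tail f)))
Fire-inc (suc i) (suc j) (s≤s i≤j) f = Fire-suc (Fire-inc i j i≤j (proj₁ (Fire-tail f))) refl

Fire-inc-top : ∀ {b} i p → suc (p i) ≡ b → Fire b i (inc i p) (inc (suc i) p)
Fire-inc-top {b} zero p top =
  ≤-reflexive (sym top) , sym (trans (cong (_∸ b) top) (n∸n≡0 b)) , refl , others
  where
  others : ∀ k → k ≢ 0 → k ≢ 1 → inc 1 p k ≡ inc 0 p k
  others zero          k≢0 _   = contradiction refl k≢0
  others (suc zero)    _   k≢1 = contradiction refl k≢1
  others (suc (suc k)) _   _   = refl
Fire-inc-top (suc i) p top = Fire-suc (Fire-inc-top i (tail p) top) refl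

inc-firable : ∀ {b i j} p → i ≤ j → p j < b → b ≤ inc i p j → j ≡ i × suc (p i) ≡ b
inc-firable {b} {i} {j} p i≤j pj<b b≤ with m≤n⇒m<n∨m≡n i≤j
... | inj₁ i<j  = contradiction (subst (b ≤_) (inc-above i p j i<j) b≤) (<⇒≱ pj<b)
... | inj₂ refl = refl , ≤-antisym pj<b (subst (b ≤_) (inc-at i p) b≤)

inc-below-unfirable : ∀ {c i j} p → j < i → ¬ suc c ≤ inc i p j
inc-below-unfirable {c} {i} {j} p j<i b≤ with subst (suc c ≤_) (inc-below i p j j<i) b≤
... | ()

NonzeroUpTo : ℕ → Part → Set
NonzeroUpTo i y = Σ ℕ λ k → k ≤ i × y k ≢ 0

inc-nonzeroUpTo : ∀ i p {y} → y ≈ inc i p → NonzeroUpTo i y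
inc-nonzeroUpTo i p y≈ = i , ≤-refl , 1+n≢0 ∘ trans (sym (trans (y≈ i) (inc-at i p)))

inc-suc-zeroUpTo : ∀ i p {y} → y ≈ inc (suc i) p → ¬ NonzeroUpTo i y
inc-suc-zeroUpTo i p y≈ (k , k≤i , yk≢0) = yk≢0 (trans (y≈ k) (inc-below (suc i) p k (s≤s k≤i)))

P-Fire : ∀ {i b n j p q} → P i b n p → i ≤ j → Fire b j p q → P i b n q
P-Fire {i} {b} {j = j} {q = q} (r , low) i≤j f@(_ , _ , _ , rest) = step j r f , low′
  where
  low′ : ∀ k → k < i → q k ≡ b ∸ 1
  low′ k k<i = trans (rest k (<⇒≢ k<j) (<⇒≢ (m<n⇒m<1+n k<j))) (low k k<i)
    where k<j = <-≤-trans k<i i≤j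

P-suc⇒P : ∀ {i b n p} → P (suc i) b n p → P i b n p
P-suc⇒P (r , low) = r , λ k k<i → low k (m<n⇒m<1+n k<i)

P-extend : ∀ {i b n p} → P i b n p → p i ≡ b ∸ 1 → P (suc i) b n p
P-extend {i} {b} {p = p} (r , low) top = r , low′
  where
  low′ : ∀ k → k < suc i → p k ≡ b ∸ 1
  low′ k k<si with m<1+n⇒m<n∨m≡n k<si
  ... | inj₁ k<i  = low k k<i
  ... | inj₂ refl = top

module Stages (c n : ℕ) where

  b : ℕ
  b = suc c

  -- S_{i+1} = S_i ∪ Added (suc i); I_i consists of the elements of Added i with a missing successor.
  Added : ℕ → Part → Set
  Added zero    = S₀ b n
  Added (suc i) = C b n i

  Added⊆S : ∀ i {x} → Added i x → S b n i x
  Added⊆S zero    x∈S₀ = x∈S₀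
  Added⊆S (suc i) x∈C  = inj₂ x∈C

  I⇔Added : ∀ i x → I b n i x ⇔ (Added i x × SuccNotIn b (S b n i) x)
  I⇔Added zero    x = mk⇔ id id
  I⇔Added (suc i) x = mk⇔ id id

  AddedIsInc : ℕ → Set
  AddedIsInc i = ∀ x → Added i x ⇔ (Σ Part λ p → P i b n p × (x ≈ inc i p))

  S⊆NonzeroUpTo : ℕ → Set
  S⊆NonzeroUpTo i = ∀ y → S b n i y → NonzeroUpTo i y

  fires-to-next : ∀ {i p} → P (suc i) b n p → Fire b i (inc i p) (inc (suc i) p)
  fires-to-next {i} {p} p∈P = Fire-inc-top i p (cong suc (proj₂ p∈P i (n<1+n i)))

  escape : ∀ i → AddedIsInc i → ∀ {p j y} → P i b n p →
           Fire b j (inc i p) y → ¬ S b n i y → j ≡ i × P (suc i) b n p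
  escape i added {p} {j} {y} p∈P f y∉S with i ≤? j
  ... | no i≰j = contradiction (proj₁ f) (inc-below-unfirable p (≰⇒> i≰j))
  ... | yes i≤j with b ≤? p j
  ...   | no b≰pj = let j≡i , top = inc-firable p i≤j (≰⇒> b≰pj) (proj₁ f)
                    in j≡i , P-extend p∈P (suc-injective top)
  ...   | yes b≤pj = contradiction (Added⊆S i (from (added y) (fire b j p , p′∈P , y≈))) y∉S
    where
    fired : Fire b j p (fire b j p)
    fired = Fire-fire j p b≤pj
    p′∈P : P i b n (fire b j p)
    p′∈P = P-Fire p∈P i≤j fired
    y≈ : y ≈ inc i (fire b j p)
    y≈ = Fire-functional f (Fire-inc i j i≤j fired)

  I-char : ∀ i → AddedIsInc i → S⊆NonzeroUpTo i →
    (x : Part) → I b n i x ⇔ (Σ Part λ p → P (suc i) b n p × (x ≈ inc i p))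
  I-char i added supp x = mk⇔ to′ from′
    where
    to′ : I b n i x → Σ Part λ p → P (suc i) b n p × (x ≈ inc i p)
    to′ x∈I with to (I⇔Added i x) x∈I
    ... | x∈A , y , (j , f) , y∉S with to (added x) x∈A
    ... | p , p∈P , x≈ = p , proj₂ (escape i added p∈P (Fire-resp-≈ x≈ ≈-refl f) y∉S) , x≈
    from′ : (Σ Part λ p → P (suc i) b n p × (x ≈ inc i p)) → I b n i x
    from′ (p , p∈P , x≈) = from (I⇔Added i x)
      ( from (added x) (p , P-suc⇒P p∈P , x≈)
      , inc (suc i) p , (i , Fire-resp-≈ (≈-sym x≈) ≈-refl (fires-to-next p∈P))
      , inc-suc-zeroUpTo i p ≈-refl ∘ supp (inc (suc i) p))

  C-char : ∀ i → AddedIsInc i → S⊆NonzeroUpTo i → AddedIsInc (suc i)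
  C-char i added supp y = mk⇔ to′ from′
    where
    to′ : C b n i y → Σ Part λ p → P (suc i) b n p × (y ≈ inc (suc i) p)
    to′ ((x , x∈I , (j , f)) , y∉S) with to (I-char i added supp x) x∈I
    ... | p , p∈P , x≈ with escape i added (P-suc⇒P p∈P) (Fire-resp-≈ x≈ ≈-refl f) y∉S
    ... | refl , _ = p , p∈P , Fire-functional (Fire-resp-≈ x≈ ≈-refl f) (fires-to-next p∈P)
    from′ : (Σ Part λ p → P (suc i) b n p × (y ≈ inc (suc i) p)) → C b n i y
    from′ (p , p∈P , y≈) =
      ( inc i p , from (I-char i added supp (inc i p)) (p , p∈P , ≈-refl)
      , (i , Fire-resp-≈ ≈-refl (≈-sym y≈) (fires-to-next p∈P)))
      , inc-suc-zeroUpTo i p y≈ ∘ supp y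

  S⊆NonzeroUpTo-suc : ∀ i → AddedIsInc (suc i) → S⊆NonzeroUpTo i → S⊆NonzeroUpTo (suc i)
  S⊆NonzeroUpTo-suc i added supp y (inj₁ y∈S) =
    let k , k≤i , yk≢0 = supp y y∈S in k , m≤n⇒m≤1+n k≤i , yk≢0
  S⊆NonzeroUpTo-suc i added supp y (inj₂ y∈C) =
    let p , _ , y≈ = to (added y) y∈C in inc-nonzeroUpTo (suc i) p y≈

  invariant : ∀ i → AddedIsInc i × S⊆NonzeroUpTo i
  invariant zero =
    (λ x → mk⇔ (λ (p , r , x≈) → p , (r , λ _ ()) , x≈) (λ (p , (r , _) , x≈) → p , r , x≈)) ,
    λ y (p , _ , y≈) → inc-nonzeroUpTo 0 p y≈
  invariant (suc i) =
    let added , supp = invariant i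
        added′ = C-char i added supp
    in added′ , S⊆NonzeroUpTo-suc i added′ supp

lemma4 : (b n : ℕ) → 2 ≤ b → (i : ℕ) →
    ((x : Part) → I b n i x ⇔ (Σ Part λ p → P (suc i) b n p × (x ≈ inc i p)))
    × ((y : Part) → C b n i y ⇔ (Σ Part λ p → P (suc i) b n p × (y ≈ inc (suc i) p)))
lemma4 zero    n () i
lemma4 (suc c) n _  i = I-char i added supp , C-char i added supp
  where
  open Stages c n
  added = proj₁ (invariant i)
  supp  = proj₂ (invariant i)
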